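{- Suppose $x,y\in{}^\omega(\omega-\{0\})$ are strictly increasing with $1\ll x\ll y$, and $T$ is a $y$-squeezed tree. Then $T$ is an $x$-squeezed tree.
   Context: For $x,y\in{}^\omega(\omega-\{0\})$, $x\ll y$ means $x(n)\le y(n)$ for all $n$ and $y(n)/x(n)\to\infty$; $1\ll x$ means $x(n)\to\infty$. Let $x$ be strictly increasing and $n\in\omega$. A triple $(j,k,m)$ is an $x$-bound system above $n$ iff $k\in\omega$, $j,m$ are functions from $\{0,\dots,k\}$ into $\omega$, $j(0)>x(n+m(0)+1)$, and $j(l+1)>x(j(l)+m(l+1)+1)$ for all $l<k$. A tree $T\subseteq{}^{<\omega}\omega$ (closed under initial segments) is $(j,k,m,\eta)$-squeezed iff $\mathrm{dom}(\eta)=\{(l,t):l\le k,\ t\le m(l)\}$, $\eta(l,t)\in{}^{j(l)}\omega$ for each $(l,t)\in\mathrm{dom}(\eta)$, and every $\nu\in T$ is comparable (one is an initial segment of the other) with some $\eta(l,t)$. $T$ is $x$-squeezed iff for every $n\in\omega$ there are an $x$-bound system $(j,k,m)$ above $n$ and some $\eta$ such that $T$ is $(j,k,m,\eta)$-squeezed. -}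

module Defs where

open import Data.Nat using (ℕ; zero; suc; _+_; _*_; _≤_; _<_)
open import Data.List using (List; _++_; length)
open import Data.Product using (Σ; ∃; ∃-syntax; _×_; _,_)
open import Data.Sum using (_⊎_)
open import Relation.Binary.PropositionalEquality using (_≡_)

-- Sequences in ω^ω are functions ℕ → ℕ; finite sequences (elements of ω^{<ω}) are lists.
Seq : Set
Seq = ℕ → ℕ

Positive : Seq → Set
Positive x = ∀ n → 0 < x n

StrictlyIncreasing : Seq → Set
StrictlyIncreasing x = ∀ m n → m < n → x m < x n

OneLL : Seq → Set
OneLL x = ∀ M → ∃[ N ] ∀ n → N ≤ n → M ≤ x n

-- x ≪ y : x(n) ≤ y(n) for all n and y(n)/x(n) → ∞
-- (y(n)/x(n) ≥ M  iff  M * x(n) ≤ y(n), as x(n) > 0)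
_≪_ : Seq → Seq → Set
x ≪ y = (∀ n → x n ≤ y n)
      × (∀ M → ∃[ N ] ∀ n → N ≤ n → M * x n ≤ y n)

_⊑_ : List ℕ → List ℕ → Set
u ⊑ v = ∃[ w ] u ++ w ≡ v

Comparable : List ℕ → List ℕ → Set
Comparable u v = u ⊑ v ⊎ v ⊑ u

IsTree : (List ℕ → Set) → Set
IsTree T = ∀ u v → u ⊑ v → T v → T u

-- (j,k,m) is an x-bound system above n
-- (j, m only matter on {0,…,k}; they are given as functions on ℕ)
BoundSystem : Seq → ℕ → (ℕ → ℕ) → ℕ → (ℕ → ℕ) → Set
BoundSystem x n j k m =
  (x (n + m 0 + 1) < j 0) ×
  (∀ l → l < k → x (j l + m (suc l) + 1) < j (suc l))

-- T is (j,k,m,η)-squeezed; η(l,t) is only relevant for l ≤ k, t ≤ m(l)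
Squeezed : (List ℕ → Set) → (ℕ → ℕ) → ℕ → (ℕ → ℕ) → (ℕ → ℕ → List ℕ) → Set
Squeezed T j k m η =
  (∀ l t → l ≤ k → t ≤ m l → length (η l t) ≡ j l) ×
  (∀ ν → T ν → ∃[ l ] ∃[ t ] (l ≤ k × t ≤ m l × Comparable ν (η l t)))

XSqueezed : Seq → (List ℕ → Set) → Set
XSqueezed x T = ∀ n → ∃[ j ] ∃[ k ] ∃[ m ] ∃[ η ]
  (BoundSystem x n j k m × Squeezed T j k m η)

module Submission where

-- Being squeezed is monotone in the bounding sequence: the
-- conditions defining an x-bound system, x(n+m(0)+1) < j(0) and
-- x(j(l)+m(l+1)+1) < j(l+1), only get weaker when x is replaced by a
-- pointwise smaller sequence.  Hence every y-bound system above n is an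
-- x-bound system above n whenever x ≤ y pointwise, and the same witness
-- (j, k, m, η) that shows T to be y-squeezed shows it to be x-squeezed.

open import Defs
open import Data.List using (List)
open import Data.Nat using (ℕ; _≤_)
open import Data.Nat.Properties using (≤-<-trans)
open import Data.Product using (_,_; proj₁)

_≤ₚ_ : Seq → Seq → Set
x ≤ₚ y = ∀ n → x n ≤ y n

boundSystem-mono : ∀ {x y} → x ≤ₚ y → ∀ n j k m
  → BoundSystem y n j k m → BoundSystem x n j k m
boundSystem-mono x≤y _ _ _ _ (first , step) =
  ≤-<-trans (x≤y _) first , λ l l<k → ≤-<-trans (x≤y _) (step l l<k)

xSqueezed-mono : ∀ {x y} → x ≤ₚ y → ∀ T → XSqueezed y T → XSqueezed x T
xSqueezed-mono x≤y T squeezedʸ n with squeezedʸ n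
... | j , k , m , η , bounds , squeezed =
  j , k , m , η , boundSystem-mono x≤y n j k m bounds , squeezed

lemma7p4 : (x y : Seq) → Positive x → Positive y
    → StrictlyIncreasing x → StrictlyIncreasing y
    → OneLL x → x ≪ y
    → (T : List ℕ → Set) → IsTree T → XSqueezed y T → XSqueezed x T
lemma7p4 x y _ _ _ _ _ x≪y T _ = xSqueezed-mono (proj₁ x≪y) T
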